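{- Let $(\mathcal{M},w)$ be a pointed $\Theta$-model and let $\mathcal{M}^{un(w)}$ be its intuitionistic unravelling around $w$. Then: (1) $\mathcal{M}^{un(w)}$ is a $\Theta$-model; (2) the relation $B=\{\langle(w_n;\bar a_m),(\bar w_n;\bar a_m\odot\bar w_n)\rangle,\langle(\bar w_n;\bar a_m\odot\bar w_n),(w_n;\bar a_m)\rangle : \bar w_n\in W^{un(w)},\ m\ge0,\ \bar a_m\in A^m_{w_n}\}$ is an $\mathsf{IL}$-asimulation both from $(\mathcal{M},w_n,\bar a_m)$ to $(\mathcal{M}^{un(w)},\bar w_n,\bar a_m\odot\bar w_n)$ and from $(\mathcal{M}^{un(w)},\bar w_n,\bar a_m\odot\bar w_n)$ to $(\mathcal{M},w_n,\bar a_m)$, for every $\bar w_n\in W^{un(w)}$ and every $\bar a_m\in A^m_{w_n}$; (3) $Tp_{\mathsf{IL}}(\mathcal{M},v_k,\bar c_m/\bar a_m)=Tp_{\mathsf{IL}}(\mathcal{M}^{un(w)},\bar v_k,\bar c_m/\bar a_m\odot\bar v_k)$ for any $\bar v_k\in W^{un(w)}$, $m\ge0$, $\bar a_m\in A^m_{v_k}$, and any tuple $\bar c_m$ of pairwise distinct constants outside $\Theta$; (4) $Tp_{\mathsf{IL}}(\mathcal{M}^{un(w)},\bar u_n,\bar c_m/\bar a_m\odot\bar u_n)=Tp_{\mathsf{IL}}(\mathcal{M}^{un(w)},\bar v_k,\bar c_m/\bar a_m\odot\bar v_k)$ for any $\bar u_n,\bar v_k\in W^{un(w)}$ with $u_n=v_k$,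 $m\ge0$, $\bar a_m\in A^m_{v_k}$, and any such $\bar c_m$.
   Context: A signature $\Theta$ consists of predicate letters of positive arities and individual constants; no function symbols. A (Kripke) $\Theta$-model is $\mathcal{M}=\langle W,\prec,\mathfrak{A},\mathbb{H}\rangle$: $W\neq\emptyset$; $\prec$ a partial order; $\mathfrak{A}_w=(A_w,I_w)$ a classical $\Theta$-structure for each $w$, with $A_w\cap A_v=\emptyset$ for $w\neq v$; homomorphisms $\mathbb{H}_{wv}:\mathfrak{A}_w\to\mathfrak{A}_v$ for $w\prec v$ (preserving predicates and constants) with $\mathbb{H}_{ww}=id$, $\mathbb{H}_{wu}=\mathbb{H}_{vu}\circ\mathbb{H}_{wv}$. $[\mathcal{M},w]$ is the restriction to $\{v:w\prec v\}$; for fresh pairwise distinct constants $\bar c_n$ and $\bar a_n\in A_w^n$, $([\mathcal{M},w],\bar c_n/\bar a_n)$ expands it with $c_i$ denoting $\mathbb{H}_{wv}(a_i)$ at $v$. Unravelling: $W^{un(w)}$ is the set of finite sequences $\bar u_n=(u_1,\dots,u_n)$ ($n\ge1$) of elements of $W$ with $u_1=w$ and $u_i\prec u_{i+1}$ for $i<n$; $\prec^{un(w)}$ is the initial-segment order ($\bar u_k\prec^{un(w)}\bar v_n$ iff $k\le n$ and $\bar u_k=\bar v_k$); $A^{un(w)}_{\bar u_n}=\{(a;\bar u_n):a\in A_{u_n}\}$; $I^{un(w)}_{\bar u_n}(P)$ holds of $((a_1;\bar u_n),\dots,(a_m;\bar u_n))$ iff $I_{u_n}(P)(a_1,\dots,a_m)$;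 $I^{un(w)}_{\bar u_n}(c)=(I_{u_n}(c);\bar u_n)$; for $\bar u_k\prec^{un(w)}\bar u_n$, $\mathbb{H}^{un(w)}_{\bar u_k\bar u_n}((a;\bar u_k))=(\mathbb{H}_{u_ku_n}(a);\bar u_n)$. Notation: $\bar a_m\odot\bar u_n=((a_1;\bar u_n),\dots,(a_m;\bar u_n))$. $\mathsf{IL}$: intuitionistic first-order logic without equality with Kripke semantics (atoms true at $w$ iff true in $\mathfrak{A}_w$; $\bot$ never; $\to$ and $\forall$ quantify over all $v\succ w$, transporting values by $\mathbb{H}_{wv}$; $\exists$ ranges over $A_w$). $Tp_{\mathsf{IL}}(\mathcal{M},w,\bar c_n/\bar a_n)$ = (sentences over $\Theta\cup\{\bar c_n\}$ true at $w$ in $([\mathcal{M},w],\bar c_n/\bar a_n)$, those false there). $\mathsf{IL}$-asimulation: fix pairwise distinct constants $c_1,c_2,\dots\notin\Theta$. A relation $A$ is an $\mathsf{IL}$-asimulation from $(\mathcal{M}_1,w_1,\bar a_n)$ to $(\mathcal{M}_2,w_2,\bar b_n)$ iff it relates pairs $(w;\bar\alpha_l)$ ($w\in W_i$) to pairs $(v;\bar\beta_l)$ ($v\in W_j$), $\{i,j\}=\{1,2\}$, $(w_1;\bar a_n)A(w_2;\bar b_n)$, and whenever $(w;\bar\alpha_l)A(v;\bar\beta_l)$ with $\bar\alpha_l\in(A_i)^l_w,\bar\beta_l\in(A_j)^l_v$: atomic sentences over $\Theta\cup\{c_1..c_l\}$ true at $w$ in $([\mathcal{M}_i,w],\bar c_l/\bar\alpha_l)$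 are true at $v$ in $([\mathcal{M}_j,v],\bar c_l/\bar\beta_l)$; if $v\prec_j t$ some $u\succ_i w$ has $(u;\mathbb{H}_{wu}\langle\bar\alpha\rangle)A(t;\mathbb{H}_{vt}\langle\bar\beta\rangle)$ and $(t;\mathbb{H}_{vt}\langle\bar\beta\rangle)A(u;\mathbb{H}_{wu}\langle\bar\alpha\rangle)$; each $\alpha'\in(A_i)_w$ has $\beta'\in(A_j)_v$ with $(w;\bar\alpha{}^\frown\alpha')A(v;\bar\beta{}^\frown\beta')$; each $t\succ_j v$, $\beta'\in(A_j)_t$ have $u\succ_i w$, $\alpha'\in(A_i)_u$ with $(u;\mathbb{H}_{wu}\langle\bar\alpha\rangle^\frown\alpha')A(t;\mathbb{H}_{vt}\langle\bar\beta\rangle^\frown\beta')$. -}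

module Defs where

open import Data.Nat using (ℕ; zero; suc; _≤_)
import Data.Nat
open import Data.Fin using (Fin)
open import Data.Vec using (Vec; []; _∷_; map; lookup; _∷ʳ_)
open import Data.List using (List; []; _∷_; length; take)
open import Data.List.Properties using (∷-injective)
open import Data.Product using (Σ; _×_; _,_; proj₁; proj₂; ∃)
open import Data.Sum using (_⊎_; inj₁; inj₂)
open import Data.Empty using (⊥)
open import Relation.Nullary using (¬_)
open import Relation.Binary.PropositionalEquality using (_≡_; refl; subst; sym)
open import Function.Bundles using (_⇔_)

record Signature : Set₁ where
  field
    Pred   : Set
    ar     : Pred → ℕ
    ar-pos : ∀ P → 1 ≤ ar P
    Const  : Set

open Signature public

-- Θ ∪ {c₁,…,c_m}: m fresh pairwise distinct constants, named by Fin m.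
_+c_ : Signature → ℕ → Signature
Θ +c m = record
  { Pred = Pred Θ ; ar = ar Θ ; ar-pos = ar-pos Θ ; Const = Const Θ ⊎ Fin m }

-- Raw Kripke structures (data only) and the model conditions.
-- Domains are a W-indexed family of types, so A_w and A_v are disjoint
-- for w ≠ v by construction.

record RawModel (Θ : Signature) : Set₁ where
  field
    W     : Set
    _≺_   : W → W → Set
    ≺-refl : ∀ w → w ≺ w
    A     : W → Set
    IP    : (w : W) (P : Pred Θ) → Vec (A w) (ar Θ P) → Set
    IC    : (w : W) → Const Θ → A w
    H     : ∀ {w v} → w ≺ v → A w → A v

open RawModel public

-- A Θ-model: ≺ is a partial order (reflexive via ≺-refl, transitive,
-- antisymmetric; a relation, i.e. proof-irrelevant), each H_wv is a
-- homomorphism, H_ww = id and H_wu = H_vu ∘ H_wv.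
record IsModel {Θ : Signature} (M : RawModel Θ) : Set where
  field
    ≺-irrelevant : ∀ {w v} (p q : _≺_ M w v) → p ≡ q
    ≺-trans      : ∀ {w v u} → _≺_ M w v → _≺_ M v u → _≺_ M w u
    ≺-antisym    : ∀ {w v} → _≺_ M w v → _≺_ M v w → w ≡ v
    H-pred       : ∀ {w v} (p : _≺_ M w v) (P : Pred Θ) (as : Vec (A M w) (ar Θ P)) →
                   IP M w P as → IP M v P (map (H M p) as)
    H-const      : ∀ {w v} (p : _≺_ M w v) (c : Const Θ) → H M p (IC M w c) ≡ IC M v c
    H-id         : ∀ {w} (a : A M w) → H M (≺-refl M w) a ≡ a
    H-comp       : ∀ {w v u} (p : _≺_ M w v) (q : _≺_ M v u) (a : A M w) →
                   H M (≺-trans p q) a ≡ H M q (H M p a)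

record Model (Θ : Signature) : Set₁ where
  field
    raw     : RawModel Θ
    isModel : IsModel raw

open Model public

-- Formulas of IL (no equality), with n free variables (de Bruijn).

data Term (Θ : Signature) (n : ℕ) : Set where
  var : Fin n → Term Θ n
  con : Const Θ → Term Θ n

data Formula (Θ : Signature) : ℕ → Set where
  atom : ∀ {n} (P : Pred Θ) → Vec (Term Θ n) (ar Θ P) → Formula Θ n
  ⊥'   : ∀ {n} → Formula Θ n
  _∧'_ _∨'_ _⇒'_ : ∀ {n} → Formula Θ n → Formula Θ n → Formula Θ n
  ∀' ∃' : ∀ {n} → Formula Θ (suc n) → Formula Θ n

Sentence : Signature → Set
Sentence Θ = Formula Θ 0

module _ {Θ : Signature} (M : RawModel Θ) where

  evalT : ∀ {n} (w : W M) → Vec (A M w) n → Term Θ n → A M w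
  evalT w ρ (var i) = lookup ρ i
  evalT w ρ (con c) = IC M w c

  sat : ∀ {n} (w : W M) → Vec (A M w) n → Formula Θ n → Set
  sat w ρ (atom P ts) = IP M w P (map (evalT w ρ) ts)
  sat w ρ ⊥' = ⊥
  sat w ρ (φ ∧' ψ) = sat w ρ φ × sat w ρ ψ
  sat w ρ (φ ∨' ψ) = sat w ρ φ ⊎ sat w ρ ψ
  sat w ρ (φ ⇒' ψ) = ∀ v (p : _≺_ M w v) →
    sat v (map (H M p) ρ) φ → sat v (map (H M p) ρ) ψ
  sat w ρ (∀' φ) = ∀ v (p : _≺_ M w v) (a : A M v) → sat v (a ∷ map (H M p) ρ) φ
  sat w ρ (∃' φ) = Σ (A M w) λ a → sat w (a ∷ ρ) φ

-- ([M,w], c̄_m/ā_m): the restriction of M to {v : w ≺ v}, expanded by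
-- constants c_i denoting H_wv(a_i) at v.

Cone : ∀ {Θ} (M : RawModel Θ) (w : W M) {m : ℕ} → Vec (A M w) m → RawModel (Θ +c m)
Cone {Θ} M w ā = record
  { W      = Σ (W M) (λ v → _≺_ M w v)
  ; _≺_    = λ x y → _≺_ M (proj₁ x) (proj₁ y)
  ; ≺-refl = λ x → ≺-refl M (proj₁ x)
  ; A      = λ x → A M (proj₁ x)
  ; IP     = λ x → IP M (proj₁ x)
  ; IC     = ic
  ; H      = H M
  }
  where
  ic : (x : Σ (W M) (λ v → _≺_ M w v)) → Const Θ ⊎ Fin _ → A M (proj₁ x)
  ic (v , p) (inj₁ c) = IC M v c
  ic (v , p) (inj₂ i) = H M p (lookup ā i)

root : ∀ {Θ} (M : RawModel Θ) (w : W M) {m : ℕ} (ā : Vec (A M w) m) → W (Cone M w ā)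
root M w ā = w , ≺-refl M w

_⊨[_,_]_ : ∀ {Θ} (M : RawModel Θ) (w : W M) {m : ℕ} (ā : Vec (A M w) m) →
           Sentence (Θ +c m) → Set
M ⊨[ w , ā ] φ = sat (Cone M w ā) (root M w ā) [] φ

record Type (Θ : Signature) : Set₁ where
  field
    true  : Sentence Θ → Set
    false : Sentence Θ → Set

open Type public

Tp : ∀ {Θ} (M : RawModel Θ) (w : W M) {m : ℕ} (ā : Vec (A M w) m) → Type (Θ +c m)
Tp M w ā = record { true = λ φ → M ⊨[ w , ā ] φ ; false = λ φ → ¬ (M ⊨[ w , ā ] φ) }

_≈Tp_ : ∀ {Θ} → Type Θ → Type Θ → Set
T ≈Tp T' = ∀ φ → (true T φ ⇔ true T' φ) × (false T φ ⇔ false T' φ)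

-- IL-asimulations.  A relation between pairs (w; ᾱ_l) of M_i and
-- (v; β̄_l) of M_j with {i,j} = {1,2} is given by its two cross parts
-- R₁₂ (pairs from M₁ to M₂) and R₂₁ (pairs from M₂ to M₁).

Rel : ∀ {Θ} → RawModel Θ → RawModel Θ → Set₁
Rel M N = (w : W M) (v : W N) (l : ℕ) → Vec (A M w) l → Vec (A N v) l → Set

AsimClauses : ∀ {Θ} (Mi Mj : RawModel Θ) → Rel Mi Mj → Rel Mj Mi → Set
AsimClauses {Θ} Mi Mj R R' =
  ∀ w v l (α : Vec (A Mi w) l) (β : Vec (A Mj v) l) → R w v l α β →
    (∀ (P : Pred Θ) (ts : Vec (Term (Θ +c l) 0) (ar Θ P)) →
        Mi ⊨[ w , α ] atom P ts → Mj ⊨[ v , β ] atom P ts)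
  × (∀ t (q : _≺_ Mj v t) → Σ (W Mi) λ u → Σ (_≺_ Mi w u) λ p →
        R u t l (map (H Mi p) α) (map (H Mj q) β)
      × R' t u l (map (H Mj q) β) (map (H Mi p) α))
  × (∀ (α' : A Mi w) → Σ (A Mj v) λ β' → R w v (suc l) (α ∷ʳ α') (β ∷ʳ β'))
  × (∀ t (q : _≺_ Mj v t) (β' : A Mj t) →
        Σ (W Mi) λ u → Σ (_≺_ Mi w u) λ p → Σ (A Mi u) λ α' →
          R u t (suc l) (map (H Mi p) α ∷ʳ α') (map (H Mj q) β ∷ʳ β'))

IsAsim : ∀ {Θ} (M₁ M₂ : RawModel Θ) (R₁₂ : Rel M₁ M₂) (R₂₁ : Rel M₂ M₁)
         (w₁ : W M₁) (w₂ : W M₂) {n : ℕ} → Vec (A M₁ w₁) n → Vec (A M₂ w₂) n → Set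
IsAsim M₁ M₂ R₁₂ R₂₁ w₁ w₂ {n} ā b̄ =
  R₁₂ w₁ w₂ n ā b̄ × AsimClauses M₁ M₂ R₁₂ R₂₁ × AsimClauses M₂ M₁ R₂₁ R₁₂

module Unravelling {Θ : Signature} (𝕄 : Model Θ) (w : W (raw 𝕄)) where
  private
    M = raw 𝕄
    open IsModel (isModel 𝕄)

  data Chain : W M → List (W M) → Set where
    []  : ∀ {u} → Chain u []
    _∷_ : ∀ {u v vs} → _≺_ M u v → Chain v vs → Chain u (v ∷ vs)

  -- W^{un(w)}: sequences (w, u₂, …, u_n) with consecutive elements ≺-related
  Wun : Set
  Wun = Σ (List (W M)) (Chain w)

  seq : Wun → List (W M)
  seq (us , _) = w ∷ us

  last' : W M → List (W M) → W M
  last' u [] = u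
  last' u (v ∷ vs) = last' v vs

  last : Wun → W M
  last (us , _) = last' w us

  _≺un_ : Wun → Wun → Set
  ū ≺un v̄ = (length (seq ū) ≤ length (seq v̄)) × (take (length (seq ū)) (seq v̄) ≡ seq ū)

  ≺un-refl : ∀ ū → ū ≺un ū
  ≺un-refl (us , _) = ≤-refl′ (suc (length us)) , take-all (w ∷ us)
    where
    ≤-refl′ : ∀ n → n ≤ n
    ≤-refl′ zero = Data.Nat.z≤n
    ≤-refl′ (suc n) = Data.Nat.s≤s (≤-refl′ n)
    take-all : ∀ (xs : List (W M)) → take (length xs) xs ≡ xs
    take-all [] = refl
    take-all (x ∷ xs) rewrite take-all xs = refl

  reach : ∀ {u vs} → Chain u vs → _≺_ M u (last' u vs)
  reach {u} [] = ≺-refl M u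
  reach (p ∷ c) = ≺-trans p (reach c)

  fromTo : ∀ {u vs} → Chain u vs → (k : ℕ) → _≺_ M (last' u (take k vs)) (last' u vs)
  fromTo c zero = reach c
  fromTo {u} [] (suc k) = ≺-refl M u
  fromTo (p ∷ c) (suc k) = fromTo c k

  ≺un⇒≺ : ∀ {ū v̄} → ū ≺un v̄ → _≺_ M (last ū) (last v̄)
  ≺un⇒≺ {us , _} {vs , c} (_ , e) =
    subst (λ xs → _≺_ M (last' w xs) (last' w vs)) (proj₂ (∷-injective e)) (fromTo c (length us))

  -- A^{un(w)}_ū = {(a; ū) : a ∈ A_{u_n}}
  data UnElt (ū : Wun) : Set where
    _⨾ : A M (last ū) → UnElt ū

  elt : ∀ {ū} → UnElt ū → A M (last ū)
  elt (a ⨾) = a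

  Mun : RawModel Θ
  Mun = record
    { W      = Wun
    ; _≺_    = _≺un_
    ; ≺-refl = ≺un-refl
    ; A      = UnElt
    ; IP     = λ ū P as → IP M (last ū) P (map elt as)
    ; IC     = λ ū c → _⨾ {ū} (IC M (last ū) c)
    ; H      = λ {ū} {v̄} p a → _⨾ {v̄} (H M (≺un⇒≺ {ū} {v̄} p) (elt a))
    }

  odot : ∀ {m} (ū : Wun) → Vec (A M (last ū)) m → Vec (UnElt ū) m
  odot ū ā = map (_⨾ {ū}) ā

  syntax odot ū ā = ā ⊙ ū

  data B→ : Rel M Mun where
    b→ : ∀ ū l (ā : Vec (A M (last ū)) l) → B→ (last ū) ū l ā (ā ⊙ ū)

  data B← : Rel Mun M where
    b← : ∀ ū l (ā : Vec (A M (last ū)) l) → B← ū (last ū) l (ā ⊙ ū) ā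

{-# OPTIONS --safe #-}
-- Taking last points, ū ↦ last ū and (a; ū) ↦ a, is a bounded morphism from the
-- unravelling onto M: it is monotone, every M-successor t of last ū is the last point
-- of the one-step extension of ū by t, and it is onto each domain.  IL-truth is
-- invariant under bounded morphisms, which gives (3); (4) is (3) applied at ū and at v̄.
-- The same two facts (follow a step of M^{un(w)} by its last point, a step of M by
-- extending the sequence) are exactly the back-and-forth clauses for B.
module Submission where

open import Defs
open import Axiom.UniquenessOfIdentityProofs.WithK using (uip)
open import Data.Nat using (ℕ; suc; s≤s; _⊓_)
open import Data.Nat.Properties using (≤-irrelevant; ≤-refl; ≤-trans; ≤-antisym; m≤n⇒m⊓n≡m)
open import Data.Vec using (Vec; []; _∷_; _∷ʳ_; map)
open import Data.Vec.Properties using (map-∘; map-cong; lookup-map; map-∷ʳ)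
open import Data.List using (List; []; _∷_; length; take; _++_)
open import Data.List.Properties using (∷-injective; length-++-≤ˡ; take-all; take-take)
open import Data.Product using (Σ; ∃-syntax; _×_; _,_; proj₁; proj₂; swap)
open import Data.Product.Function.NonDependent.Propositional using (_×-⇔_)
open import Data.Sum using (inj₁; inj₂)
open import Data.Sum.Function.Propositional using (_⊎-⇔_)
open import Function using (_∘_)
open import Function.Bundles using (_⇔_; mk⇔; Equivalence)
open import Function.Construct.Identity using (⇔-id)
open import Function.Construct.Symmetry using (⇔-sym)
open import Function.Construct.Composition using () renaming (equivalence to ⇔-trans)
open import Function.Related.TypeIsomorphisms using (¬-cong-⇔)
open import Relation.Binary.PropositionalEquality
open ≡-Reasoning
open Equivalence using (to; from)

record BoundedMorphism {Θ : Signature} (N M : RawModel Θ) : Set where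
  field
    f            : W N → W M
    g            : ∀ {y} → A N y → A M (f y)
    g-surjective : ∀ {y} (a : A M (f y)) → ∃[ b ] g b ≡ a
    f-mono       : ∀ {y z} → _≺_ N y z → _≺_ M (f y) (f z)
    f-back       : ∀ {y x} → _≺_ M (f y) x → ∃[ z ] (_≺_ N y z × f z ≡ x)
    g-H          : ∀ {y z} (q : _≺_ N y z) (a : A N y) → g (H N q a) ≡ H M (f-mono q) (g a)
    g-IP         : ∀ y P (as : Vec (A N y) (ar Θ P)) → IP N y P as ⇔ IP M (f y) P (map g as)
    g-IC         : ∀ y c → g (IC N y c) ≡ IC M (f y) c
    H-irrelevant : ∀ {x x′} (p p′ : _≺_ M x x′) (a : A M x) → H M p a ≡ H M p′ a

module _ {Θ : Signature} {N M : RawModel Θ} (h : BoundedMorphism N M) where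
  open BoundedMorphism h

  g-map-H : ∀ {n y z} (q : _≺_ N y z) (p : _≺_ M (f y) (f z)) (ρ : Vec (A N y) n) →
            map g (map (H N q) ρ) ≡ map (H M p) (map g ρ)
  g-map-H q p ρ = begin
    map g (map (H N q) ρ)   ≡⟨ map-∘ g (H N q) ρ ⟨
    map (g ∘ H N q) ρ       ≡⟨ map-cong (λ a → trans (g-H q a) (H-irrelevant _ p (g a))) ρ ⟩
    map (H M p ∘ g) ρ       ≡⟨ map-∘ (H M p) g ρ ⟩
    map (H M p) (map g ρ)   ∎

  g-evalT : ∀ {n} y (ρ : Vec (A N y) n) t → g (evalT N y ρ t) ≡ evalT M (f y) (map g ρ) t
  g-evalT y ρ (var i) = sym (lookup-map i g ρ)
  g-evalT y ρ (con c) = g-IC y c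

  mutual
    sat-⇔ : ∀ {n} y (ρ : Vec (A N y) n) φ → sat N y ρ φ ⇔ sat M (f y) (map g ρ) φ
    sat-⇔ y ρ (atom P ts) =
      subst (λ bs → IP N y P _ ⇔ IP M (f y) P bs) g-terms (g-IP y P (map (evalT N y ρ) ts))
      where
      g-terms : map g (map (evalT N y ρ) ts) ≡ map (evalT M (f y) (map g ρ)) ts
      g-terms = trans (sym (map-∘ g _ ts)) (map-cong (g-evalT y ρ) ts)
    sat-⇔ y ρ ⊥' = ⇔-id _
    sat-⇔ y ρ (φ ∧' ψ) = sat-⇔ y ρ φ ×-⇔ sat-⇔ y ρ ψ
    sat-⇔ y ρ (φ ∨' ψ) = sat-⇔ y ρ φ ⊎-⇔ sat-⇔ y ρ ψ
    sat-⇔ y ρ (φ ⇒' ψ) = mk⇔ preserve reflect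
      where
      IH : ∀ χ {z} (q : _≺_ N y z) (p : _≺_ M (f y) (f z)) →
           sat N z (map (H N q) ρ) χ ⇔ sat M (f z) (map (H M p) (map g ρ)) χ
      IH χ q p = sat-⇔-≡ _ (map (H N q) ρ) (g-map-H q p ρ) χ
      preserve : sat N y ρ (φ ⇒' ψ) → sat M (f y) (map g ρ) (φ ⇒' ψ)
      preserve hyp x p hφ with f-back p
      ... | z , q , refl = to (IH ψ q p) (hyp z q (from (IH φ q p) hφ))
      reflect : sat M (f y) (map g ρ) (φ ⇒' ψ) → sat N y ρ (φ ⇒' ψ)
      reflect hyp z q hφ =
        from (IH ψ q (f-mono q)) (hyp (f z) (f-mono q) (to (IH φ q (f-mono q)) hφ))
    sat-⇔ y ρ (∀' φ) = mk⇔ preserve reflect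
      where
      IH : ∀ {z} (q : _≺_ N y z) (p : _≺_ M (f y) (f z)) (b : A N z) →
           sat N z (b ∷ map (H N q) ρ) φ ⇔ sat M (f z) (g b ∷ map (H M p) (map g ρ)) φ
      IH q p b = sat-⇔-≡ _ (b ∷ map (H N q) ρ) (cong (g b ∷_) (g-map-H q p ρ)) φ
      preserve : sat N y ρ (∀' φ) → sat M (f y) (map g ρ) (∀' φ)
      preserve hyp x p a with f-back p
      ... | z , q , refl with g-surjective a
      ... | b , refl = to (IH q p b) (hyp z q b)
      reflect : sat M (f y) (map g ρ) (∀' φ) → sat N y ρ (∀' φ)
      reflect hyp z q b = from (IH q (f-mono q) b) (hyp (f z) (f-mono q) (g b))
    sat-⇔ y ρ (∃' φ) = mk⇔ preserve reflect
      where
      preserve : sat N y ρ (∃' φ) → sat M (f y) (map g ρ) (∃' φ)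
      preserve (b , hφ) = g b , to (sat-⇔ y (b ∷ ρ) φ) hφ
      reflect : sat M (f y) (map g ρ) (∃' φ) → sat N y ρ (∃' φ)
      reflect (a , hφ) with g-surjective a
      ... | b , refl = b , from (sat-⇔ y (b ∷ ρ) φ) hφ

    sat-⇔-≡ : ∀ {n} y (ρ : Vec (A N y) n) {σ} → map g ρ ≡ σ → ∀ φ → sat N y ρ φ ⇔ sat M (f y) σ φ
    sat-⇔-≡ y ρ refl φ = sat-⇔ y ρ φ

Tp-≈ : ∀ {Θ} {M N : RawModel Θ} {w v m} {ā : Vec (A M w) m} {b̄ : Vec (A N v) m} →
       (∀ φ → M ⊨[ w , ā ] φ ⇔ N ⊨[ v , b̄ ] φ) → Tp M w ā ≈Tp Tp N v b̄
Tp-≈ truth φ = truth φ , ¬-cong-⇔ (truth φ)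

⊨-subst : ∀ {Θ} (M : RawModel Θ) {x y} (e : x ≡ y) {m} (ā : Vec (A M y) m) φ →
          M ⊨[ x , subst (λ z → Vec (A M z) m) (sym e) ā ] φ ⇔ M ⊨[ y , ā ] φ
⊨-subst M refl ā φ = ⇔-id _

take-length-++ : ∀ {X : Set} (xs ys : List X) → take (length xs) (xs ++ ys) ≡ xs
take-length-++ [] ys = refl
take-length-++ (x ∷ xs) ys = cong (x ∷_) (take-length-++ xs ys)

module UnravellingProperties {Θ : Signature} (𝕄 : Model Θ) (w : W (raw 𝕄)) where
  open Unravelling 𝕄 w
  private
    M = raw 𝕄
  open IsModel (isModel 𝕄)

  H-irrelevant : ∀ {u v} (p q : _≺_ M u v) (a : A M u) → H M p a ≡ H M q a
  H-irrelevant p q a = cong (λ r → H M r a) (≺-irrelevant p q)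

  chain-irrelevant : ∀ {u vs} (c d : Chain u vs) → c ≡ d
  chain-irrelevant [] [] = refl
  chain-irrelevant (p ∷ c) (q ∷ d) = cong₂ Chain._∷_ (≺-irrelevant p q) (chain-irrelevant c d)

  Wun-≡ : ∀ {us vs} (c : Chain w us) (d : Chain w vs) → us ≡ vs → _≡_ {A = Wun} (us , c) (vs , d)
  Wun-≡ c d refl = cong (_ ,_) (chain-irrelevant c d)

  ≺un-irrelevant : ∀ {ū v̄} (p q : ū ≺un v̄) → p ≡ q
  ≺un-irrelevant (ū≤v̄ , e) (ū≤v̄′ , e′) = cong₂ _,_ (≤-irrelevant ū≤v̄ ū≤v̄′) (uip e e′)

  ≺un-trans : ∀ {ū v̄ z̄} → ū ≺un v̄ → v̄ ≺un z̄ → ū ≺un z̄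
  ≺un-trans {ū} {v̄} {z̄} (ū≤v̄ , v̄-prefix) (v̄≤z̄ , z̄-prefix) = ≤-trans ū≤v̄ v̄≤z̄ , (begin
    take ∣ū∣ (seq z̄)              ≡⟨ cong (λ k → take k (seq z̄)) (m≤n⇒m⊓n≡m ū≤v̄) ⟨
    take (∣ū∣ ⊓ ∣v̄∣) (seq z̄)      ≡⟨ take-take ∣ū∣ ∣v̄∣ (seq z̄) ⟨
    take ∣ū∣ (take ∣v̄∣ (seq z̄))   ≡⟨ cong (take ∣ū∣) z̄-prefix ⟩
    take ∣ū∣ (seq v̄)              ≡⟨ v̄-prefix ⟩
    seq ū                         ∎)
    where
    ∣ū∣ = length (seq ū)
    ∣v̄∣ = length (seq v̄)

  ≺un-antisym : ∀ {ū v̄} → ū ≺un v̄ → v̄ ≺un ū → ū ≡ v̄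
  ≺un-antisym {us , c} {vs , d} (ū≤v̄ , v̄-prefix) (v̄≤ū , _) =
    Wun-≡ c d (proj₂ (∷-injective (begin
      w ∷ us                              ≡⟨ v̄-prefix ⟨
      take (length (w ∷ us)) (w ∷ vs)     ≡⟨ cong (λ k → take k (w ∷ vs)) (≤-antisym ū≤v̄ v̄≤ū) ⟩
      take (length (w ∷ vs)) (w ∷ vs)     ≡⟨ take-all _ (w ∷ vs) ≤-refl ⟩
      w ∷ vs                              ∎)))

  map-elt-H : ∀ {n ū v̄} (p : ū ≺un v̄) (as : Vec (UnElt ū) n) →
              map elt (map (H Mun {ū} {v̄} p) as) ≡ map (H M (≺un⇒≺ {ū} {v̄} p)) (map elt as)
  map-elt-H p as = trans (sym (map-∘ _ _ as)) (map-∘ _ _ as)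

  Mun-isModel : IsModel Mun
  Mun-isModel = record
    { ≺-irrelevant = λ {ū} {v̄} → ≺un-irrelevant {ū} {v̄}
    ; ≺-trans      = λ {ū} {v̄} {z̄} → ≺un-trans {ū} {v̄} {z̄}
    ; ≺-antisym    = λ {ū} {v̄} → ≺un-antisym {ū} {v̄}
    ; H-pred       = λ {ū} {v̄} p P as hyp →
        subst (IP M (last v̄) P) (sym (map-elt-H p as))
              (H-pred (≺un⇒≺ {ū} {v̄} p) P (map elt as) hyp)
    ; H-const      = λ {ū} {v̄} p c → cong _⨾ (H-const (≺un⇒≺ {ū} {v̄} p) c)
    ; H-id         = λ { (a ⨾) → cong _⨾ (trans (H-irrelevant _ _ a) (H-id a)) }
    ; H-comp       = λ { p q (a ⨾) → cong _⨾ (trans (H-irrelevant _ _ a) (H-comp _ _ a)) }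
    }

  chain-snoc : ∀ {u vs t} → Chain u vs → _≺_ M (last' u vs) t → Chain u (vs ++ t ∷ [])
  chain-snoc [] p = p ∷ []
  chain-snoc (q ∷ c) p = q ∷ chain-snoc c p

  last'-snoc : ∀ u vs t → last' u (vs ++ t ∷ []) ≡ t
  last'-snoc u [] t = refl
  last'-snoc u (v ∷ vs) t = last'-snoc v vs t

  ≺⇒≺un : ∀ {ū t} → _≺_ M (last ū) t → ∃[ z̄ ] (ū ≺un z̄ × last z̄ ≡ t)
  ≺⇒≺un {us , c} {t} p =
      (us ++ t ∷ [] , chain-snoc c p)
    , (s≤s (length-++-≤ˡ us) , cong (w ∷_) (take-length-++ us _))
    , last'-snoc w us t

  ⊙-H : ∀ {ū z̄ n} (p : ū ≺un z̄) (q : _≺_ M (last ū) (last z̄)) (ā : Vec (A M (last ū)) n) →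
        map (H Mun {ū} {z̄} p) (ā ⊙ ū) ≡ map (H M q) ā ⊙ z̄
  ⊙-H {ū} {z̄} p q ā = begin
    map (H Mun {ū} {z̄} p) (ā ⊙ ū)              ≡⟨ map-∘ (H Mun {ū} {z̄} p) _⨾ ā ⟨
    map (λ a → H M (≺un⇒≺ {ū} {z̄} p) a ⨾) ā   ≡⟨ map-cong (λ a → cong _⨾ (H-irrelevant _ q a)) ā ⟩
    map (λ a → H M q a ⨾) ā                    ≡⟨ map-∘ _⨾ (H M q) ā ⟩
    map (H M q) ā ⊙ z̄                          ∎

  ⊙-H-∷ʳ : ∀ {ū z̄ n} (p : ū ≺un z̄) (q : _≺_ M (last ū) (last z̄)) (ā : Vec (A M (last ū)) n) b →
           map (H Mun {ū} {z̄} p) (ā ⊙ ū) ∷ʳ (b ⨾) ≡ (map (H M q) ā ∷ʳ b) ⊙ z̄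
  ⊙-H-∷ʳ {ū} {z̄} p q ā b =
    trans (cong (_∷ʳ (b ⨾)) (⊙-H {ū} {z̄} p q ā)) (sym (map-∷ʳ _⨾ b _))

  unravel-morphism : ∀ v̄ {m} (ā : Vec (A M (last v̄)) m) →
                     BoundedMorphism (Cone Mun v̄ (ā ⊙ v̄)) (Cone M (last v̄) ā)
  unravel-morphism v̄ ā = record
    { f            = point
    ; g            = elt
    ; g-surjective = λ a → a ⨾ , refl
    ; f-mono       = λ { {ȳ , _} {z̄ , _} q → ≺un⇒≺ {ȳ} {z̄} q }
    ; f-back       = λ {y} {x} → back {y} {x}
    ; g-H          = λ q a → refl
    ; g-IP         = λ y P as → ⇔-id _
    ; g-IC         = λ { (ȳ , p) (inj₁ c) → refl
                       ; (ȳ , p) (inj₂ i) →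
                           cong (H M (≺un⇒≺ {v̄} {ȳ} p)) (cong (elt {v̄}) (lookup-map i (_⨾ {v̄}) ā)) }
    ; H-irrelevant = H-irrelevant
    }
    where
    point : Σ Wun (v̄ ≺un_) → Σ (W M) (_≺_ M (last v̄))
    point (ȳ , p) = last ȳ , ≺un⇒≺ {v̄} {ȳ} p
    back : ∀ {y x} → _≺_ M (proj₁ (point y)) (proj₁ x) → ∃[ z ] (proj₁ y ≺un proj₁ z × point z ≡ x)
    back {ȳ , pȳ} {x , px} p with ≺⇒≺un {ȳ} p
    ... | z̄ , q , refl =
      (z̄ , ≺un-trans {v̄} {ȳ} {z̄} pȳ q) , q , cong (last z̄ ,_) (≺-irrelevant _ px)

  unravel-⊨ : ∀ v̄ {m} (ā : Vec (A M (last v̄)) m) φ → M ⊨[ last v̄ , ā ] φ ⇔ Mun ⊨[ v̄ , ā ⊙ v̄ ] φ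
  -- The morphism sends the root of [M^{un(w)}, v̄] to that of [M, last v̄] only up to
  -- the proof of last v̄ ≺ last v̄.
  unravel-⊨ v̄ ā φ =
    ⇔-sym (subst (λ r → Mun ⊨[ v̄ , ā ⊙ v̄ ] φ ⇔ sat (Cone M (last v̄) ā) (last v̄ , r) [] φ)
                 (≺-irrelevant _ _)
                 (sat-⇔ (unravel-morphism v̄ ā) (root Mun v̄ (ā ⊙ v̄)) [] φ))

  unravel-Tp : ∀ v̄ {m} (ā : Vec (A M (last v̄)) m) → Tp M (last v̄) ā ≈Tp Tp Mun v̄ (ā ⊙ v̄)
  unravel-Tp v̄ ā = Tp-≈ (unravel-⊨ v̄ ā)

  unravel-Tp-last : ∀ ū v̄ (e : last ū ≡ last v̄) {m} (ā : Vec (A M (last v̄)) m) →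
                    Tp Mun ū (subst (λ x → Vec (A M x) m) (sym e) ā ⊙ ū) ≈Tp Tp Mun v̄ (ā ⊙ v̄)
  unravel-Tp-last ū v̄ e ā = Tp-≈ λ φ →
    ⇔-trans (⇔-sym (unravel-⊨ ū _ φ)) (⇔-trans (⊨-subst M e ā φ) (unravel-⊨ v̄ ā φ))

  B-pair : ∀ z̄ {l} (ā : Vec (A M (last z̄)) l) {c̄} → c̄ ≡ ā ⊙ z̄ →
           B← z̄ (last z̄) l c̄ ā × B→ (last z̄) z̄ l ā c̄
  B-pair z̄ ā refl = b← z̄ _ ā , b→ z̄ _ ā

  B-along : ∀ {ū z̄} (p : ū ≺un z̄) {t} (e : last z̄ ≡ t) (q : _≺_ M (last ū) t)
            {l} (ā : Vec (A M (last ū)) l) →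
            B← z̄ t l (map (H Mun {ū} {z̄} p) (ā ⊙ ū)) (map (H M q) ā)
            × B→ t z̄ l (map (H M q) ā) (map (H Mun {ū} {z̄} p) (ā ⊙ ū))
  B-along {ū} {z̄} p refl q ā = B-pair z̄ _ (⊙-H {ū} {z̄} p q ā)

  B←-along-∷ʳ : ∀ {ū z̄} (p : ū ≺un z̄) {t} (e : last z̄ ≡ t) (q : _≺_ M (last ū) t)
                {l} (ā : Vec (A M (last ū)) l) (b : A M t) →
                Σ (UnElt z̄) λ a →
                  B← z̄ t (suc l) (map (H Mun {ū} {z̄} p) (ā ⊙ ū) ∷ʳ a) (map (H M q) ā ∷ʳ b)
  B←-along-∷ʳ {ū} {z̄} p refl q ā b = b ⨾ , proj₁ (B-pair z̄ _ (⊙-H-∷ʳ {ū} {z̄} p q ā b))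

  B→-clauses : AsimClauses M Mun B→ B←
  B→-clauses _ _ _ _ _ (b→ ū l ā) =
      (λ P ts → to (unravel-⊨ ū ā (atom P ts)))
    , (λ t q → last t , ≺un⇒≺ {ū} {t} q , swap (B-along {ū} {t} q refl _ ā))
    , (λ a → a ⨾ , proj₂ (B-pair ū (ā ∷ʳ a) (sym (map-∷ʳ _⨾ a ā))))
    , back
    where
    back : ∀ t (q : ū ≺un t) (b : UnElt t) →
           Σ (W M) λ u → Σ (_≺_ M (last ū) u) λ p → Σ (A M u) λ a →
             B→ u t (suc l) (map (H M p) ā ∷ʳ a) (map (H Mun {ū} {t} q) (ā ⊙ ū) ∷ʳ b)
    back t q (b ⨾) = last t , ≺un⇒≺ {ū} {t} q , b , proj₂ (B-pair t _ (⊙-H-∷ʳ {ū} {t} q _ ā b))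

  B←-clauses : AsimClauses Mun M B← B→
  B←-clauses _ _ _ _ _ (b← ū l ā) =
      (λ P ts → from (unravel-⊨ ū ā (atom P ts)))
    , (λ t q → let z̄ , p , e = ≺⇒≺un {ū} q in z̄ , p , B-along {ū} {z̄} p e q ā)
    , forth
    , (λ t q b → let z̄ , p , e = ≺⇒≺un {ū} q in z̄ , p , B←-along-∷ʳ {ū} {z̄} p e q ā b)
    where
    forth : ∀ (a : UnElt ū) → Σ (A M (last ū)) λ b → B← ū (last ū) (suc l) ((ā ⊙ ū) ∷ʳ a) (ā ∷ʳ b)
    forth (a ⨾) = a , proj₁ (B-pair ū (ā ∷ʳ a) (sym (map-∷ʳ _⨾ a ā)))

lemma2p30 : ∀ {Θ : Signature} (𝕄 : Model Θ) (w : W (raw 𝕄)) →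
    let open Unravelling 𝕄 w in
    -- (1) M^{un(w)} is a Θ-model
    IsModel Mun
    -- (2) B is an IL-asimulation in both directions
    × (∀ (ū : Wun) {m : ℕ} (ā : Vec (A (raw 𝕄) (last ū)) m) →
         IsAsim (raw 𝕄) Mun B→ B← (last ū) ū ā (ā ⊙ ū)
         × IsAsim Mun (raw 𝕄) B← B→ ū (last ū) (ā ⊙ ū) ā)
    -- (3) types are preserved by unravelling
    × (∀ (v̄ : Wun) {m : ℕ} (ā : Vec (A (raw 𝕄) (last v̄)) m) →
         Tp (raw 𝕄) (last v̄) ā ≈Tp Tp Mun v̄ (ā ⊙ v̄))
    -- (4) types in M^{un(w)} depend only on the last element
    × (∀ (ū v̄ : Wun) (e : last ū ≡ last v̄) {m : ℕ} (ā : Vec (A (raw 𝕄) (last v̄)) m) →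
         Tp Mun ū (subst (λ x → Vec (A (raw 𝕄) x) m) (sym e) ā ⊙ ū)
           ≈Tp Tp Mun v̄ (ā ⊙ v̄))
lemma2p30 𝕄 w =
    Mun-isModel
  , (λ ū ā → (b→ ū _ ā , B→-clauses , B←-clauses) , (b← ū _ ā , B←-clauses , B→-clauses))
  , unravel-Tp
  , unravel-Tp-last
  where
  open Unravelling 𝕄 w
  open UnravellingProperties 𝕄 w
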